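{- Every strongly matchable positive integer is an M-number.
   Context: For a positive integer $n$, let $D(n)$ be its set of positive divisors and $\tau(n)=|D(n)|$. A coprime arithmetic progression of $N$ integers is a set $\{a+kq:0\le k<N\}$ with integers $a$ and $q\ge1$, $\gcd(a,q)=1$. A positive integer $n$ is strongly matchable if for every coprime arithmetic progression $I$ of $\tau(n)$ integers there is a bijection $\psi:D(n)\to I$ with $\gcd(d,\psi(d))=1$ for all $d\in D(n)$. An M-number is a positive integer not divisible by $p^p$ for any prime $p$. -}

module Defs where

open import Data.Nat as ℕ using (ℕ; _≥_; _^_; NonZero)
open import Data.Nat.Divisibility using (_∣_; _∣?_)
open import Data.Nat.Primality using (Prime)
open import Data.Integer as ℤ using (ℤ; +_)
open import Data.Integer.Coprimality using (Coprime)
open import Data.Fin using (Fin; toℕ)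
open import Data.List using (length; filter; applyUpTo)
open import Data.Product using (Σ; _×_; proj₁)
open import Function.Bundles using (_⤖_; Bijection)
open import Relation.Binary.PropositionalEquality using (_≡_)
open import Relation.Nullary using (¬_)

-- D(n): the set of positive divisors of n, as a subtype of ℕ.
-- (For n ≥ 1, every d with d ∣ n is automatically positive.)
D : ℕ → Set
D n = Σ ℕ (λ d → d ∣ n)

τ : ℕ → ℕ
τ n = length (filter (λ d → d ∣? n) (applyUpTo ℕ.suc n))

AP : ℤ → ℕ → ℕ → Set
AP a q N = Σ ℤ (λ x → Σ (Fin N) (λ k → x ≡ a ℤ.+ (+ toℕ k) ℤ.* (+ q)))

IsCoprimeAP : ℤ → ℕ → Set
IsCoprimeAP a q = (q ≥ 1) × Coprime a (+ q)

StronglyMatchable : ℕ → Set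
StronglyMatchable n =
  (a : ℤ) (q : ℕ) → IsCoprimeAP a q →
  Σ (D n ⤖ AP a q (τ n)) (λ ψ →
    (d : D n) → Coprime (+ proj₁ d) (proj₁ (Bijection.to ψ d)))

MNumber : ℕ → Set
MNumber n = (p : ℕ) → Prime p → ¬ (p ^ p ∣ n)

{-# OPTIONS --safe #-}
module Submission where

-- Match D(n) with the coprime progression 0, 1, …, τ(n) − 1 and suppose p ^ p ∣ n. Each of the
-- ⌈τ(n)/p⌉ multiples of p in it is matched with a divisor d prime to p, and each such d yields
-- the p + 1 divisors d, dp, …, dp^p, distinct for distinct d by uniqueness of the decomposition
-- d p^i. Hence ⌈τ(n)/p⌉ (p + 1) ≤ τ(n) ≤ p ⌈τ(n)/p⌉, which is impossible.

open import Defs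
open import Data.Nat using (ℕ; _≥_)
open import Data.Nat.Base
  using (zero; suc; _+_; _*_; _∸_; _^_; _≤_; _<_; s≤s; NonZero; >-nonZero; ≢-nonZero⁻¹; nonTrivial⇒≢1)
open import Data.Nat.Properties
open import Data.Nat.DivMod using (_/_; _%_; m≡m%n+[m/n]*n; m%n<n; m/n*n≤m)
open import Data.Nat.Divisibility
open import Data.Nat.Primality using (Prime; euclidsLemma; prime⇒nonZero; prime⇒nonTrivial)
import Data.Nat.Coprimality as ℕ
open import Data.Integer as ℤ using (ℤ; +_)
import Data.Integer.Properties as ℤ
open import Data.Fin using (Fin; toℕ; fromℕ<)
open import Data.Fin.Properties using (toℕ-injective; toℕ-fromℕ<; toℕ≤pred[n]; injective⇒≤; ¬Fin0; *↔×)
open import Data.Product using (_×_; _,_; proj₁; proj₂; map₂)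
open import Data.Sum using (inj₁; inj₂)
open import Function.Bundles using (_⤖_; _↣_; Bijection; Injection; mk⤖; mk↣)
open import Function.Construct.Composition using (_↣-∘_; _⤖-∘_)
open import Function.Definitions using (Injective)
open import Function.Properties.Inverse using (↔⇒↣)
open import Algebra.Properties.CommutativeSemigroup *-commutativeSemigroup using (x∙yz≈y∙xz)
open import Relation.Binary.PropositionalEquality
open import Relation.Nullary using (¬_; contradiction)

private variable
  c d i k m n p N : ℕ

∣-irrelevant : .{{NonZero n}} → (x y : m ∣ n) → x ≡ y
∣-irrelevant {n} {zero} (divides q eq) _ = contradiction (trans eq (*-zeroʳ q)) (≢-nonZero⁻¹ n)
∣-irrelevant {n} {suc m} (divides q₁ eq₁) (divides q₂ eq₂)
  with refl ← *-cancelʳ-≡ q₁ q₂ (suc m) (trans (sym eq₁) eq₂)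
  = cong (divides q₁) (≡-irrelevant eq₁ eq₂)

D-≡ : .{{NonZero n}} → {x y : D n} → proj₁ x ≡ proj₁ y → x ≡ y
D-≡ {x = d , _} {y = .d , _} refl = cong (d ,_) (∣-irrelevant _ _)

index⤖ : (a : ℤ) (q : ℕ) → AP a q N ⤖ Fin N
index⤖ {N} a q = mk⤖ (injective , λ k → (_ , k , refl) , λ { refl → refl })
  where
  injective : Injective _≡_ _≡_ (λ (x : AP a q N) → proj₁ (proj₂ x))
  injective {_ , _ , refl} {_ , _ , refl} refl = refl

∣AP₀₁∣≡index : (x : AP (+ 0) 1 N) → ℤ.∣ proj₁ x ∣ ≡ toℕ (Bijection.to (index⤖ (+ 0) 1) x)
∣AP₀₁∣≡index (_ , k , refl) = cong ℤ.∣_∣ (trans (ℤ.+-identityˡ (+ toℕ k ℤ.* + 1)) (ℤ.*-identityʳ (+ toℕ k)))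

^-monoʳ-∣ : ∀ m → i ≤ k → m ^ i ∣ m ^ k
^-monoʳ-∣ {i} {k} m i≤k = subst (m ^ i ∣_) m^i*m^[k∸i]≡m^k (m∣m*n (m ^ (k ∸ i)))
  where
  m^i*m^[k∸i]≡m^k : m ^ i * m ^ (k ∸ i) ≡ m ^ k
  m^i*m^[k∸i]≡m^k = trans (sym (^-distribˡ-+-* m i (k ∸ i))) (cong (m ^_) (m+[n∸m]≡n i≤k))

*p^-injective : .{{NonZero p}} → ∀ {a b} i j → ¬ p ∣ a → ¬ p ∣ b → a * p ^ i ≡ b * p ^ j → a ≡ b × i ≡ j
*p^-injective zero zero _ _ eq = trans (sym (*-identityʳ _)) (trans eq (*-identityʳ _)) , refl
*p^-injective {p} {a} {b} zero (suc j) p∤a _ eq =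
  contradiction (subst (p ∣_) (trans (sym eq) (*-identityʳ a)) (∣n⇒∣m*n b (m∣m*n (p ^ j)))) p∤a
*p^-injective {p} {a} {b} (suc i) zero _ p∤b eq =
  contradiction (subst (p ∣_) (trans eq (*-identityʳ b)) (∣n⇒∣m*n a (m∣m*n (p ^ i)))) p∤b
*p^-injective {p} {a} {b} (suc i) (suc j) p∤a p∤b eq =
  map₂ (cong suc) (*p^-injective i j p∤a p∤b (*-cancelˡ-≡ _ _ p p[ap^i]≡p[bp^j]))
  where
  open ≡-Reasoning
  p[ap^i]≡p[bp^j] : p * (a * p ^ i) ≡ p * (b * p ^ j)
  p[ap^i]≡p[bp^j] = begin
    p * (a * p ^ i) ≡⟨ x∙yz≈y∙xz p a (p ^ i) ⟩
    a * p ^ suc i   ≡⟨ eq ⟩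
    b * p ^ suc j   ≡⟨ x∙yz≈y∙xz b p (p ^ j) ⟩
    p * (b * p ^ j) ∎

module _ (p : ℕ) .{{_ : NonZero p}} {m : ℕ} where
  multiple : Fin (suc (m / p)) → Fin (suc m)
  multiple j = fromℕ< (s≤s p*j≤m)
    where
    open ≤-Reasoning
    p*j≤m : p * toℕ j ≤ m
    p*j≤m = begin
      p * toℕ j ≤⟨ *-monoʳ-≤ p (toℕ≤pred[n] j) ⟩
      p * (m / p) ≡⟨ *-comm p (m / p) ⟩
      m / p * p ≤⟨ m/n*n≤m m p ⟩
      m ∎

  toℕ-multiple : ∀ j → toℕ (multiple j) ≡ p * toℕ j
  toℕ-multiple j = toℕ-fromℕ< _

  multiple-injective : Injective _≡_ _≡_ multiple
  multiple-injective {i} {j} eq =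
    toℕ-injective (*-cancelˡ-≡ _ _ p (trans (sym (toℕ-multiple i)) (trans (cong toℕ eq) (toℕ-multiple j))))

m<[1+m/n]*n : ∀ m n .{{_ : NonZero n}} → m < suc (m / n) * n
m<[1+m/n]*n m n = begin-strict
  m                 ≡⟨ m≡m%n+[m/n]*n m n ⟩
  m % n + m / n * n <⟨ +-monoˡ-< (m / n * n) (m%n<n m n) ⟩
  n + m / n * n     ∎
  where open ≤-Reasoning

module _ (pp : Prime p) where
  private instance
    p-nonZero : NonZero p
    p-nonZero = prime⇒nonZero pp

  p^i∣m*n⇒p^i∣n : ∀ i → ¬ p ∣ m → p ^ i ∣ m * n → p ^ i ∣ n
  p^i∣m*n⇒p^i∣n zero _ _ = 1∣ _
  p^i∣m*n⇒p^i∣n {m} {n} (suc i) p∤m p^[1+i]∣mn with euclidsLemma m n pp (m*n∣⇒m∣ p (p ^ i) p^[1+i]∣mn)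
  ... | inj₁ p∣m = contradiction p∣m p∤m
  ... | inj₂ (divides r refl) =
    subst (p ^ suc i ∣_) (*-comm p r) (*-monoʳ-∣ p (p^i∣m*n⇒p^i∣n i p∤m (*-cancelˡ-∣ p p^[1+i]∣p[mr])))
    where
    p^[1+i]∣p[mr] : p ^ suc i ∣ p * (m * r)
    p^[1+i]∣p[mr] = subst (p ^ suc i ∣_) (trans (cong (m *_) (*-comm r p)) (x∙yz≈y∙xz m p r)) p^[1+i]∣mn

  d*p^i∣n : ¬ p ∣ d → d ∣ n → p ^ k ∣ n → i ≤ k → d * p ^ i ∣ n
  d*p^i∣n {d} {n} {k} {i} p∤d d∣n p^k∣n i≤k = subst (d * p ^ i ∣_) (sym n≡dr) (*-monoʳ-∣ d p^i∣r)
    where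
    n≡dr : n ≡ d * quotient d∣n
    n≡dr = m∣n⇒n≡m*quotient d∣n
    p^i∣r : p ^ i ∣ quotient d∣n
    p^i∣r = p^i∣m*n⇒p^i∣n i p∤d (subst (p ^ i ∣_) n≡dr (∣-trans (^-monoʳ-∣ p i≤k) p^k∣n))

  p-free*powers↣D : .{{NonZero n}} → p ^ k ∣ n → (f : Fin c ↣ D n) →
                    (∀ j → ¬ p ∣ proj₁ (Injection.to f j)) → (Fin c × Fin (suc k)) ↣ D n
  p-free*powers↣D {n} {k} {c} p^k∣n f p∤f = mk↣ injective
    where
    open Injection f using (to) renaming (injective to f-injective)

    times : Fin c × Fin (suc k) → D n
    times (j , i) = proj₁ (to j) * p ^ toℕ i , d*p^i∣n (p∤f j) (proj₂ (to j)) p^k∣n (toℕ≤pred[n] i)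

    injective : Injective _≡_ _≡_ times
    injective {j , i} {j′ , i′} eq
      with dⱼ≡dⱼ′ , i≡i′ ← *p^-injective (toℕ i) (toℕ i′) (p∤f j) (p∤f j′) (cong proj₁ eq)
      = cong₂ _,_ (f-injective (D-≡ dⱼ≡dⱼ′)) (toℕ-injective i≡i′)

  ¬coprime-matching : .{{NonZero n}} → p ^ p ∣ n → (φ : D n ⤖ Fin N) →
                      ¬ (∀ d → ℕ.Coprime (proj₁ d) (toℕ (Bijection.to φ d)))
  ¬coprime-matching {n} {N = zero} _ φ _ = ¬Fin0 (Bijection.to φ (1 , 1∣ n))
  ¬coprime-matching {n} {suc m} p^p∣n φ coprime =
    <⇒≱ (*-monoʳ-< (suc (m / p)) (n<1+n p)) (≤-trans [1+m/p]*[1+p]≤1+m (m<[1+m/n]*n m p))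
    where
    open Bijection φ using (to; to⁻; strictlySurjective; injection)

    divisorAt : Fin (suc (m / p)) → D n
    divisorAt j = to⁻ (multiple p j)

    to-divisorAt : ∀ j → to (divisorAt j) ≡ multiple p j
    to-divisorAt j = proj₂ (strictlySurjective (multiple p j))

    divisorAt-injective : Injective _≡_ _≡_ divisorAt
    divisorAt-injective {i} {j} eq =
      multiple-injective p (trans (sym (to-divisorAt i)) (trans (cong to eq) (to-divisorAt j)))

    p∤divisorAt : ∀ j → ¬ p ∣ proj₁ (divisorAt j)
    p∤divisorAt j p∣d = nonTrivial⇒≢1 {{prime⇒nonTrivial pp}} (coprime (divisorAt j) (p∣d , p∣to))
      where
      p∣to : p ∣ toℕ (to (divisorAt j))
      p∣to = subst (p ∣_) (sym (trans (cong toℕ (to-divisorAt j)) (toℕ-multiple p j))) (m∣m*n (toℕ j))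

    [1+m/p]*[1+p]≤1+m : suc (m / p) * suc p ≤ suc m
    [1+m/p]*[1+p]≤1+m = injective⇒≤ (Injection.injective
      (injection ↣-∘ (p-free*powers↣D p^p∣n (mk↣ divisorAt-injective) p∤divisorAt ↣-∘ ↔⇒↣ *↔×)))

proposition6p2 : (n : ℕ) → n ≥ 1 → StronglyMatchable n → MNumber n
proposition6p2 n n≥1 sm p pp p^p∣n
  with ψ , ψ-coprime ← sm (+ 0) 1 (≤-refl , λ (_ , d∣1) → ∣1⇒≡1 d∣1)
  = ¬coprime-matching pp {{>-nonZero n≥1}} p^p∣n (index⤖ (+ 0) 1 ⤖-∘ ψ) λ d →
      subst (ℕ.Coprime (proj₁ d)) (∣AP₀₁∣≡index (Bijection.to ψ d)) (ψ-coprime d)
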